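{- Let $G$ be a finite, simple, undirected, connected graph with at least two vertices. If $\gamma_t(G) = i_0(G) + 1$, then $\operatorname{diam}(G) \leq 2$.
   Context: A set $S \subseteq V(G)$ is a total dominating set of $G$ if every vertex of $G$ (including those in $S$) has a neighbor in $S$; $\gamma_t(G)$ is the minimum cardinality of a total dominating set. A set $S \subseteq V(G)$ is an isolate set if the induced subgraph $G[S]$ has at least one isolated vertex (a vertex of degree $0$ in $G[S]$). An isolate set is maximal if no proper superset of it is an isolate set. The isolate number $i_0(G)$ is the minimum cardinality of a maximal isolate set of $G$. $\operatorname{diam}(G)$ denotes the maximum distance between two vertices of $G$. -}

module Defs where

open import Data.Nat using (ℕ; zero; suc; _≤_; _+_)
open import Data.Fin using (Fin)
open import Data.Bool using (Bool; T)
open import Data.Fin.Subset using (Subset; _∈_; _⊂_; ∣_∣)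
open import Data.Product using (Σ; ∃; ∃-syntax; _×_)
open import Data.Sum using (_⊎_)
open import Relation.Nullary using (¬_)
open import Relation.Binary.PropositionalEquality using (_≡_)

record Graph (n : ℕ) : Set where
  field
    adj   : Fin n → Fin n → Bool
    sym   : ∀ u v → adj u v ≡ adj v u
    irrefl : ∀ v → adj v v ≡ Data.Bool.false

open Graph public

Adj : ∀ {n} → Graph n → Fin n → Fin n → Set
Adj G u v = T (adj G u v)

data Walk {n} (G : Graph n) : Fin n → Fin n → ℕ → Set where
  here : ∀ {v} → Walk G v v zero
  step : ∀ {u w v k} → Adj G u w → Walk G w v k → Walk G u v (suc k)

Connected : ∀ {n} → Graph n → Set
Connected G = ∀ u v → ∃[ k ] Walk G u v k

DistLe : ∀ {n} → Graph n → Fin n → Fin n → ℕ → Set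
DistLe G u v k = ∃[ l ] (l ≤ k × Walk G u v l)

DiamLe : ∀ {n} → Graph n → ℕ → Set
DiamLe G k = ∀ u v → DistLe G u v k

IsTotalDominating : ∀ {n} → Graph n → Subset n → Set
IsTotalDominating G S = ∀ v → ∃[ u ] (u ∈ S × Adj G v u)

IsIsolateSet : ∀ {n} → Graph n → Subset n → Set
IsIsolateSet G S = ∃[ v ] (v ∈ S × (∀ u → u ∈ S → ¬ Adj G v u))

IsMaximalIsolateSet : ∀ {n} → Graph n → Subset n → Set
IsMaximalIsolateSet G S = IsIsolateSet G S × (∀ T → S ⊂ T → ¬ IsIsolateSet G T)

IsMinCard : ∀ {n} → (Subset n → Set) → ℕ → Set
IsMinCard P k = (∃[ S ] (P S × ∣ S ∣ ≡ k)) × (∀ S → P S → k ≤ ∣ S ∣)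

TotalDomNumberIs : ∀ {n} → Graph n → ℕ → Set
TotalDomNumberIs G = IsMinCard (IsTotalDominating G)

IsolateNumberIs : ∀ {n} → Graph n → ℕ → Set
IsolateNumberIs G = IsMinCard (IsMaximalIsolateSet G)

-- Let S be a maximal isolate set of size i₀ and v a vertex isolated in G[S].
-- Maximality forces every vertex outside S to be adjacent to v.  If S = {v},
-- then v is adjacent to all other vertices and diam(G) ≤ 2.  Otherwise
-- connectivity yields an edge c y with c ∉ S and y ∈ S ∖ {v}, and one can pick
-- r ∈ S ∖ {v} such that every vertex of S keeps a neighbour in (S ∪ {c}) ∖ {r}:
-- r = y works unless some u ∈ S has y as its only neighbour in S ∪ {c}, and then
-- r = u works.  So (S ∪ {c}) ∖ {r} is a total dominating set of size i₀,
-- contradicting γt(G) = i₀ + 1.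
module Submission where

open import Defs
open import Data.Nat using (ℕ; suc; _≤_; _+_; z≤n; s≤s)
open import Data.Nat.Properties
  using (≤-trans; ≤-reflexive; ≤-pred; n≤1+n; +-suc; +-comm; +-monoʳ-≤; 1+n≰n; module ≤-Reasoning)
open import Data.Fin using (Fin; _≟_)
open import Data.Fin.Subset using (Subset; _∈_; _∉_; _⊂_; ∣_∣; ⁅_⁆; _∪_; _-_; inside; outside)
open import Data.Fin.Subset.Properties
  using (_∈?_; x∈⁅x⁆; x∈⁅y⁆⇒x≡y; ∣⁅x⁆∣≡1; x∈p∪q⁺; x∈p∪q⁻; q⊆p∪q;
         x∈p∧x≢y⇒x∈p-y; x∈p⇒∣p-x∣<∣p∣)
open import Data.Fin.Properties using (any?; all?)
open import Data.Vec using (_∷_; [])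
open import Data.Bool using (T)
open import Data.Product using (∃-syntax; _×_; _,_; proj₂)
open import Data.Sum using (_⊎_; inj₁; inj₂; [_,_]′)
open import Function using (_∘_)
open import Data.Empty using (⊥-elim)
open import Relation.Nullary using (¬_; Dec; yes; no)
open import Relation.Nullary.Decidable using (T?; _×-dec_; _→-dec_; ¬?; decidable-stable)
open import Relation.Unary using (Decidable)
open import Relation.Binary.PropositionalEquality using (_≡_; refl; cong; subst; _≢_; ≢-sym) renaming (sym to ≡-sym)

∣p∪q∣≤∣p∣+∣q∣ : ∀ {n} (p q : Subset n) → ∣ p ∪ q ∣ ≤ ∣ p ∣ + ∣ q ∣
∣p∪q∣≤∣p∣+∣q∣ []            []            = z≤n
∣p∪q∣≤∣p∣+∣q∣ (inside  ∷ p) (inside  ∷ q) = s≤s (≤-trans (∣p∪q∣≤∣p∣+∣q∣ p q) (+-monoʳ-≤ ∣ p ∣ (n≤1+n _)))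
∣p∪q∣≤∣p∣+∣q∣ (inside  ∷ p) (outside ∷ q) = s≤s (∣p∪q∣≤∣p∣+∣q∣ p q)
∣p∪q∣≤∣p∣+∣q∣ (outside ∷ p) (inside  ∷ q) = ≤-trans (s≤s (∣p∪q∣≤∣p∣+∣q∣ p q)) (≤-reflexive (≡-sym (+-suc ∣ p ∣ ∣ q ∣)))
∣p∪q∣≤∣p∣+∣q∣ (outside ∷ p) (outside ∷ q) = ∣p∪q∣≤∣p∣+∣q∣ p q

∣⁅x⁆∪p-y∣≤∣p∣ : ∀ {n} {x y : Fin n} (p : Subset n) → y ∈ ⁅ x ⁆ ∪ p → ∣ ⁅ x ⁆ ∪ p - y ∣ ≤ ∣ p ∣
∣⁅x⁆∪p-y∣≤∣p∣ {x = x} {y} p y∈ = ≤-pred (begin-strict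
  ∣ ⁅ x ⁆ ∪ p - y ∣   <⟨ x∈p⇒∣p-x∣<∣p∣ y∈ ⟩
  ∣ ⁅ x ⁆ ∪ p ∣       ≤⟨ ∣p∪q∣≤∣p∣+∣q∣ ⁅ x ⁆ p ⟩
  ∣ ⁅ x ⁆ ∣ + ∣ p ∣   ≡⟨ cong (_+ ∣ p ∣) (∣⁅x⁆∣≡1 x) ⟩
  suc ∣ p ∣           ∎)
  where open ≤-Reasoning

x∈⁅x⁆∪p : ∀ {n} (x : Fin n) (p : Subset n) → x ∈ ⁅ x ⁆ ∪ p
x∈⁅x⁆∪p x p = x∈p∪q⁺ (inj₁ (x∈⁅x⁆ x))

x∈⁅y⁆∪p⁻ : ∀ {n} {x y : Fin n} (p : Subset n) → x ∈ ⁅ y ⁆ ∪ p → x ≡ y ⊎ x ∈ p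
x∈⁅y⁆∪p⁻ {y = y} p x∈ with x∈p∪q⁻ ⁅ y ⁆ p x∈
... | inj₁ x∈⁅y⁆ = inj₁ (x∈⁅y⁆⇒x≡y y x∈⁅y⁆)
... | inj₂ x∈p   = inj₂ x∈p

p⊂⁅x⁆∪p : ∀ {n} {x : Fin n} {p : Subset n} → x ∉ p → p ⊂ ⁅ x ⁆ ∪ p
p⊂⁅x⁆∪p {x = x} {p} x∉p = q⊆p∪q ⁅ x ⁆ p , x , x∈⁅x⁆∪p x p , x∉p

module _ {n} (G : Graph n) where

  adjacent? : ∀ u w → Dec (Adj G u w)
  adjacent? u w = T? (adj G u w)

  adj-sym : ∀ {u w} → Adj G u w → Adj G w u
  adj-sym {u} {w} = subst T (Graph.sym G u w)

  walk-crosses : ∀ {P : Fin n → Set} → Decidable P → ∀ {a b k} → Walk G a b k →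
                 ¬ P a → P b → ∃[ x ] ∃[ y ] (¬ P x × P y × Adj G x y)
  walk-crosses P? here ¬Pa Pb = ⊥-elim (¬Pa Pb)
  walk-crosses P? (step {w = w} aw W) ¬Pa Pb with P? w
  ... | yes Pw = _ , w , ¬Pa , Pw , aw
  ... | no ¬Pw = walk-crosses P? W ¬Pw Pb

  universal-vertex⇒diam≤2 : ∀ v → (∀ z → z ≢ v → Adj G v z) → DiamLe G 2
  universal-vertex⇒diam≤2 v universal a b with a ≟ v | b ≟ v
  ... | yes refl | yes refl = 0 , z≤n , here
  ... | yes refl | no  b≢v  = 1 , s≤s z≤n , step (universal b b≢v) here
  ... | no  a≢v  | yes refl = 1 , s≤s z≤n , step (adj-sym (universal a a≢v)) here
  ... | no  a≢v  | no  b≢v  =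
    2 , s≤s (s≤s z≤n) , step (adj-sym (universal a a≢v)) (step (universal b b≢v) here)

  OnlyNeighbourIn : Subset n → Fin n → Fin n → Set
  OnlyNeighbourIn T r w = ∀ z → z ∈ T → Adj G w z → z ≡ r

  onlyNeighbourIn? : ∀ T r w → Dec (OnlyNeighbourIn T r w)
  onlyNeighbourIn? T r w = all? (λ z → (z ∈? T) →-dec adjacent? w z →-dec z ≟ r)

  neighbour-besides-or-only : ∀ T r w →
    (∃[ z ] (z ∈ T × z ≢ r × Adj G w z)) ⊎ OnlyNeighbourIn T r w
  neighbour-besides-or-only T r w with any? (λ z → (z ∈? T) ×-dec ¬? (z ≟ r) ×-dec adjacent? w z)
  ... | yes found = inj₁ found
  ... | no  none  = inj₂ λ z z∈T wz → decidable-stable (z ≟ r) (λ z≢r → none (z , z∈T , z≢r , wz))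

  module MaximalIsolate {S : Subset n} (maximal : ∀ T → S ⊂ T → ¬ IsIsolateSet G T) where

    neighbour-in-extension : ∀ {c w} → c ∉ S → w ∈ S → ∃[ z ] (z ∈ ⁅ c ⁆ ∪ S × Adj G w z)
    neighbour-in-extension {c} {w} c∉S w∈S
      with any? (λ z → (z ∈? ⁅ c ⁆ ∪ S) ×-dec adjacent? w z)
    ... | yes found = found
    ... | no  none  = ⊥-elim (maximal (⁅ c ⁆ ∪ S) (p⊂⁅x⁆∪p c∉S)
                        (w , q⊆p∪q ⁅ c ⁆ S w∈S , λ z z∈ wz → none (z , z∈ , wz)))

    module Isolated {v} (v∈S : v ∈ S) (isolated : ∀ u → u ∈ S → ¬ Adj G v u) where

      outside⇒adjacent : ∀ {u} → u ∉ S → Adj G v u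
      outside⇒adjacent u∉S with neighbour-in-extension u∉S v∈S
      ... | z , z∈ , vz with x∈⁅y⁆∪p⁻ S z∈
      ...   | inj₁ refl = vz
      ...   | inj₂ z∈S  = ⊥-elim (isolated z z∈S vz)

      exchange-dominates : ∀ {c r} → r ∈ S → r ≢ v →
        (∀ w → w ∈ S → ¬ OnlyNeighbourIn (⁅ c ⁆ ∪ S) r w) →
        IsTotalDominating G (⁅ c ⁆ ∪ S - r)
      exchange-dominates {c} {r} r∈S r≢v keeps-neighbour w with w ∈? S
      ... | no  w∉S = v , x∈p∧x≢y⇒x∈p-y (q⊆p∪q ⁅ c ⁆ S v∈S) (≢-sym r≢v) , adj-sym (outside⇒adjacent w∉S)
      ... | yes w∈S with neighbour-besides-or-only (⁅ c ⁆ ∪ S) r w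
      ...   | inj₁ (z , z∈ , z≢r , wz) = z , x∈p∧x≢y⇒x∈p-y z∈ z≢r , wz
      ...   | inj₂ only-r            = ⊥-elim (keeps-neighbour w w∈S only-r)

      exchange-vertex : ∀ {c y} → c ∉ S → y ∈ S → y ≢ v → Adj G c y →
        ∃[ r ] (r ∈ S × r ≢ v × ∀ w → w ∈ S → ¬ OnlyNeighbourIn (⁅ c ⁆ ∪ S) r w)
      exchange-vertex {c} {y} c∉S y∈S y≢v cy
        with any? (λ u → (u ∈? S) ×-dec onlyNeighbourIn? (⁅ c ⁆ ∪ S) y u)
      ... | no  none = y , y∈S , y≢v , λ w w∈S only-y → none (w , w∈S , only-y)
      ... | yes (u , u∈S , u-only-y) = u , u∈S , u≢v , keeps-neighbour
        where
        c≢member : ∀ {s} → s ∈ S → c ≢ s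
        c≢member s∈S refl = c∉S s∈S

        c∈ : c ∈ ⁅ c ⁆ ∪ S
        c∈ = x∈⁅x⁆∪p c S

        u≢v : u ≢ v
        u≢v refl = c≢member y∈S (u-only-y c c∈ (outside⇒adjacent c∉S))

        -- Such a w would be adjacent to u, hence w = y; but y is adjacent to c ≠ u.
        keeps-neighbour : ∀ w → w ∈ S → ¬ OnlyNeighbourIn (⁅ c ⁆ ∪ S) u w
        keeps-neighbour w w∈S w-only-u with neighbour-in-extension c∉S w∈S
        ... | z , z∈ , wz with w-only-u z z∈ wz
        ...   | refl with u-only-y w (q⊆p∪q ⁅ c ⁆ S w∈S) (adj-sym wz)
        ...     | refl = c≢member u∈S (w-only-u c c∈ (adj-sym cy))

      total-dominating-set-within-size : ∀ {c y} → c ∉ S → y ∈ S → y ≢ v → Adj G c y →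
        ∃[ D ] (IsTotalDominating G D × ∣ D ∣ ≤ ∣ S ∣)
      total-dominating-set-within-size {c} c∉S y∈S y≢v cy with exchange-vertex c∉S y∈S y≢v cy
      ... | r , r∈S , r≢v , keeps-neighbour =
        ⁅ c ⁆ ∪ S - r , exchange-dominates r∈S r≢v keeps-neighbour , ∣⁅x⁆∪p-y∣≤∣p∣ S (q⊆p∪q ⁅ c ⁆ S r∈S)

      edge-leaving : Connected G → ∀ {r} → r ∈ S → r ≢ v →
        ∃[ c ] ∃[ y ] (c ∉ S × y ∈ S × y ≢ v × Adj G c y)
      edge-leaving connected {r} r∈S r≢v
        with walk-crosses (λ z → (z ∈? S) ×-dec ¬? (z ≟ v)) (proj₂ (connected v r))
               (λ (_ , v≢v) → v≢v refl) (r∈S , r≢v)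
      ... | x , y , ¬Px , (y∈S , y≢v) , xy = x , y , x∉S , y∈S , y≢v , xy
        where
        x∉S : x ∉ S
        x∉S x∈S with x ≟ v
        ... | yes refl = isolated y y∈S xy
        ... | no  x≢v  = ¬Px (x∈S , x≢v)

      universal-or-dominating-set-within-size : Connected G →
        (∀ z → z ≢ v → Adj G v z) ⊎ ∃[ D ] (IsTotalDominating G D × ∣ D ∣ ≤ ∣ S ∣)
      universal-or-dominating-set-within-size connected with any? (λ z → (z ∈? S) ×-dec ¬? (z ≟ v))
      ... | no  only-v = inj₁ λ z z≢v → outside⇒adjacent (λ z∈S → only-v (z , z∈S , z≢v))
      ... | yes (r , r∈S , r≢v) with edge-leaving connected r∈S r≢v
      ...   | c , y , c∉S , y∈S , y≢v , cy = inj₂ (total-dominating-set-within-size c∉S y∈S y≢v cy)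

theorem2p3 : ∀ {n} (G : Graph n) → 2 ≤ n → Connected G →
    (γt i₀ : ℕ) → TotalDomNumberIs G γt → IsolateNumberIs G i₀ →
    γt ≡ i₀ + 1 → DiamLe G 2
theorem2p3 G _ connected γt i₀ (_ , γt-minimal)
           ((S , ((v , v∈S , isolated) , maximal) , ∣S∣≡i₀) , _) γt≡i₀+1 =
  [ universal-vertex⇒diam≤2 G v , ⊥-elim ∘ no-dominating-set-within-size ]′
    (universal-or-dominating-set-within-size connected)
  where
  open MaximalIsolate G maximal
  open Isolated v∈S isolated
  open ≤-Reasoning

  no-dominating-set-within-size : ¬ (∃[ D ] (IsTotalDominating G D × ∣ D ∣ ≤ ∣ S ∣))
  no-dominating-set-within-size (D , D-dominating , ∣D∣≤∣S∣) = 1+n≰n (begin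
    suc i₀     ≡⟨ +-comm 1 i₀ ⟩
    i₀ + 1     ≡⟨ ≡-sym γt≡i₀+1 ⟩
    γt         ≤⟨ γt-minimal D D-dominating ⟩
    ∣ D ∣      ≤⟨ ∣D∣≤∣S∣ ⟩
    ∣ S ∣      ≡⟨ ∣S∣≡i₀ ⟩
    i₀         ∎)
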